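{- Let $\{c_n\}$ and $(S,<)$ be as in the context, and let $M$ be a nonempty subset of $S$. If $M$ is bounded from above (resp. below) with respect to $<$, then $M$ has a supremum (resp. an infimum) in $(S,<)$.
   Context: $\{c_n\}_{n\ge1}$ is a sequence of positive integers with $c_n\mid c_{n+1}$ for all $n$. $S$ is the set of sequences $(q_n)_{n\ge0}$ of rationals such that: $q_0\in\mathbb{Z}$; $q_n\le1$ for $n\ge1$; if $q_1=1$ then $q_2\ne0$; if $q_m=0$ for some $m\ge1$ then $q_n=0$ for all $n\ge m$; there is a sequence of positive integers $\{a_n\}$ with $a_{n+1}\ge\frac{c_{n+1}}{c_n}a_n(a_n+1)$ for all $n\ge1$ and $q_n=c_n/a_n$ whenever $n\ge1$, $q_n\ne0$; and for each $n\ge1$, if $q_{n+1}\ne0$ then $q_{n+2}\ne0$ or $a_{n+1}>\frac{c_{n+1}}{c_n}a_n(a_n+1)$. For distinct $P=(p_n),Q=(q_n)\in S$, with $i$ the least index with $p_i\ne q_i$: $P<Q$ iff $p_0<q_0$ when $i=0$, $p_i<q_i$ when $i$ is odd, $p_i>q_i$ when $i\ge2$ is even. -}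

module Defs where

open import Data.Nat as ℕ using (ℕ; zero; suc; _+_; _*_; NonZero; >-nonZero)
import Data.Nat.DivMod as ℕD
open import Data.Nat.Divisibility using (_∣_)
open import Data.Integer as ℤ using (ℤ; +_)
open import Data.Rational as ℚ using (ℚ; 0ℚ; 1ℚ)
open import Data.Product using (Σ; ∃; ∃-syntax; _×_; _,_)
open import Data.Sum using (_⊎_)
open import Relation.Binary.PropositionalEquality using (_≡_; _≢_)

-- The sequence {c_n}_{n ≥ 1} is modelled as a function ℕ → ℕ; the value at 0 is
-- irrelevant and never constrained.
record Cseq : Set where
  field
    c    : ℕ → ℕ
    cpos : ∀ n → 1 ℕ.≤ n → 0 ℕ.< c n
    cdiv : ∀ n → 1 ℕ.≤ n → c n ∣ c (suc n)

Seq : Set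
Seq = ℕ → ℚ

module _ (C : Cseq) where
  open Cseq C

  ratio : (n : ℕ) → 1 ℕ.≤ n → ℕ
  ratio n h = ℕD._/_ (c (suc n)) (c n) {{>-nonZero (cpos n h)}}

  cOver : (n : ℕ) → (a : ℕ) → 0 ℕ.< a → ℚ
  cOver n a h = ℚ._/_ (+ c n) a {{>-nonZero h}}

  record Witness (q : Seq) (a : ℕ → ℕ) : Set where
    field
      apos   : ∀ n → 1 ℕ.≤ n → 0 ℕ.< a n
      agrow  : ∀ n (h : 1 ℕ.≤ n) → ratio n h * (a n * (a n + 1)) ℕ.≤ a (suc n)
      qval   : ∀ n (h : 1 ℕ.≤ n) → q n ≢ 0ℚ → q n ≡ cOver n (a n) (apos n h)
      strict : ∀ n (h : 1 ℕ.≤ n) → q (suc n) ≢ 0ℚ →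
               q (suc (suc n)) ≢ 0ℚ ⊎ ratio n h * (a n * (a n + 1)) ℕ.< a (suc n)

  record InS (q : Seq) : Set where
    field
      q0int  : ∃[ z ] q 0 ≡ ℚ._/_ z 1
      le1    : ∀ n → 1 ℕ.≤ n → q n ℚ.≤ 1ℚ
      one    : q 1 ≡ 1ℚ → q 2 ≢ 0ℚ
      zeros  : ∀ m → 1 ℕ.≤ m → q m ≡ 0ℚ → ∀ n → m ℕ.≤ n → q n ≡ 0ℚ
      aseq   : ∃[ a ] Witness q a

data LexAt : ℕ → ℚ → ℚ → Set where
  at0    : ∀ {x y} → x ℚ.< y → LexAt 0 x y
  atOdd  : ∀ {k x y} → x ℚ.< y → LexAt (suc (k * 2)) x y
  atEven : ∀ {k x y} → y ℚ.< x → LexAt (suc (suc (k * 2))) x y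

-- P < Q: i is the least index with p_i ≠ q_i and the entries compare as prescribed
-- (the prescribed strict comparison already forces p_i ≠ q_i).
_≺_ : Seq → Seq → Set
p ≺ q = ∃[ i ] ((∀ j → j ℕ.< i → p j ≡ q j) × LexAt i (p i) (q i))

_≈_ : Seq → Seq → Set
p ≈ q = ∀ n → p n ≡ q n

_≼_ : Seq → Seq → Set
p ≼ q = p ≺ q ⊎ p ≈ q

module _ (C : Cseq) (M : Seq → Set) where

  IsUpperBound : Seq → Set
  IsUpperBound u = InS C u × (∀ q → M q → q ≼ u)

  IsLowerBound : Seq → Set
  IsLowerBound l = InS C l × (∀ q → M q → l ≼ q)

  BoundedAbove : Set
  BoundedAbove = ∃[ u ] IsUpperBound u

  BoundedBelow : Set
  BoundedBelow = ∃[ l ] IsLowerBound l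

  IsSup : Seq → Set
  IsSup s = IsUpperBound s × (∀ u → IsUpperBound u → s ≼ u)

  IsInf : Seq → Set
  IsInf s = IsLowerBound s × (∀ l → IsLowerBound l → l ≼ s)

-- The supremum s is built greedily, entry by entry: s 0 is the largest integer part of a member of M
-- (the integer parts are bounded by that of an upper bound), and s k is the best k-th entry, in the
-- direction the order prescribes at k, among the members agreeing with s below k. At index 0 and at odd
-- indices a best entry always exists (a larger entry c k / a k means a smaller denominator a k); at an
-- even index k it can only fail to exist when the k-th entries of those members approach 0 without
-- reaching it. If the construction never gets stuck, s is a limit of members of M, hence lies in S, and
-- is the supremum. If it gets stuck at an even index K + 1, the supremum is the truncation of s after K
-- when that truncation satisfies the strictness conditions of S; otherwise it is obtained by passing, at
-- J = K - 1, to the next admissible value: the integer part plus one when J = 0, and c J / (a J + 1) when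
-- J > 0. Infima are suprema of the set of lower bounds.
module Submission where

open import Data.Nat as ℕ using (ℕ; zero; suc; _+_; _*_; _∸_; NonZero; >-nonZero; s≤s; z≤n)
import Data.Nat.Properties as ℕP
import Data.Nat.DivMod as DivMod
open import Data.Integer as ℤ using (ℤ; +_; 0ℤ)
import Data.Integer.Properties as ℤP
open import Data.Rational as ℚ using (ℚ; 0ℚ; 1ℚ)
import Data.Rational.Properties as ℚP
import Data.Rational.Unnormalised as U
import Data.Rational.Unnormalised.Properties as UP
open import Data.Integer.Solver using (module +-*-Solver)
open +-*-Solver using (solve; _:-_; _:=_)
open import Data.Bool using (Bool; true; false; not)
open import Data.Product using (Σ; ∃-syntax; _×_; _,_; proj₁; proj₂)
open import Data.Sum using (_⊎_; inj₁; inj₂)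
open import Data.Empty using (⊥; ⊥-elim)
open import Function using (_∘_)
open import Relation.Nullary using (¬_; Dec; yes; no)
open import Relation.Binary.PropositionalEquality using (_≡_; _≢_; refl; sym; trans; subst; subst₂)
open import Relation.Binary.Definitions using (tri<; tri≈; tri>)
open import Level using (0ℓ)
open import Axiom.ExcludedMiddle using (ExcludedMiddle)
open import Defs

ℚ<⇒≱ : ∀ {x y} → x ℚ.< y → ¬ (y ℚ.≤ x)
ℚ<⇒≱ x<y y≤x = ℚP.<-irrefl refl (ℚP.<-≤-trans x<y y≤x)

0≢1 : 0ℚ ≢ 1ℚ
0≢1 ()

0≤1 : 0ℚ ℚ.≤ 1ℚ
0≤1 = ℚ.*≤* (ℤ.+≤+ z≤n)

toℚᵘ-/ : ∀ i m → ℚ.toℚᵘ (i ℚ./ suc m) U.≃ U.mkℚᵘ i m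
toℚᵘ-/ i m = ℚP.toℚᵘ-fromℚᵘ (U.mkℚᵘ i m)

/-cancel-≤ : ∀ i j m n → i ℚ./ suc m ℚ.≤ j ℚ./ suc n → i ℤ.* + suc n ℤ.≤ j ℤ.* + suc m
/-cancel-≤ i j m n le =
  UP.drop-*≤* (UP.≤-respʳ-≃ (toℚᵘ-/ j n) (UP.≤-respˡ-≃ (toℚᵘ-/ i m) (ℚP.toℚᵘ-mono-≤ le)))

/-mono-≤ : ∀ i j m n → i ℤ.* + suc n ℤ.≤ j ℤ.* + suc m → i ℚ./ suc m ℚ.≤ j ℚ./ suc n
/-mono-≤ i j m n le = ℚP.toℚᵘ-cancel-≤
  (UP.≤-respʳ-≃ (UP.≃-sym (toℚᵘ-/ j n)) (UP.≤-respˡ-≃ (UP.≃-sym (toℚᵘ-/ i m)) (U.*≤* le)))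

/1-cancel-≤ : ∀ i j → i ℚ./ 1 ℚ.≤ j ℚ./ 1 → i ℤ.≤ j
/1-cancel-≤ i j le = subst₂ ℤ._≤_ (ℤP.*-identityʳ i) (ℤP.*-identityʳ j) (/-cancel-≤ i j 0 0 le)

/1-mono-≤ : ∀ {i j} → i ℤ.≤ j → i ℚ./ 1 ℚ.≤ j ℚ./ 1
/1-mono-≤ {i} {j} le = /-mono-≤ i j 0 0 (subst₂ ℤ._≤_ (sym (ℤP.*-identityʳ i)) (sym (ℤP.*-identityʳ j)) le)

/1<suc/1 : ∀ i → i ℚ./ 1 ℚ.< ℤ.suc i ℚ./ 1
/1<suc/1 i = ℚP.≰⇒> (λ le → ℤP.<⇒≱ (ℤP.suc[i]≤j⇒i<j ℤP.≤-refl) (/1-cancel-≤ (ℤ.suc i) i le))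

/1<suc/1⇒≤ : ∀ i j → i ℚ./ 1 ℚ.< ℤ.suc j ℚ./ 1 → i ℤ.≤ j
/1<suc/1⇒≤ i j lt = ℤP.≮⇒≥ (λ j<i → ℚ<⇒≱ lt (/1-mono-≤ {ℤ.suc j} {i} (ℤP.i<j⇒suc[i]≤j j<i)))

∣w-z∣≤∣w-z′∣⇒z′≤z : ∀ {w z z′} → z ℤ.≤ w → z′ ℤ.≤ w →
                    ℤ.∣ w ℤ.- z ∣ ℕ.≤ ℤ.∣ w ℤ.- z′ ∣ → z′ ℤ.≤ z
∣w-z∣≤∣w-z′∣⇒z′≤z {w} {z} {z′} z≤w z′≤w d≤d′ =
  ℤP.0≤i-j⇒j≤i (subst (0ℤ ℤ.≤_) (difference w z z′) (ℤP.i≤j⇒0≤j-i w-z≤w-z′))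
  where
  w-z≤w-z′ : w ℤ.- z ℤ.≤ w ℤ.- z′
  w-z≤w-z′ = subst₂ ℤ._≤_ (ℤP.0≤i⇒+∣i∣≡i (ℤP.i≤j⇒0≤j-i z≤w)) (ℤP.0≤i⇒+∣i∣≡i (ℤP.i≤j⇒0≤j-i z′≤w))
    (ℤ.+≤+ d≤d′)
  difference : ∀ w z z′ → (w ℤ.- z′) ℤ.- (w ℤ.- z) ≡ z ℤ.- z′
  difference = solve 3 (λ w z z′ → (w :- z′) :- (w :- z) := z :- z′) refl

c/suc-anti-≤ : ∀ c {a b} → b ℕ.≤ a → + c ℚ./ suc a ℚ.≤ + c ℚ./ suc b
c/suc-anti-≤ c {a} {b} b≤a = /-mono-≤ (+ c) (+ c) a b
  (subst₂ ℤ._≤_ (ℤP.pos-* c (suc b)) (ℤP.pos-* c (suc a)) (ℤ.+≤+ (ℕP.*-monoʳ-≤ c (s≤s b≤a))))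

c/suc-cancel-≤ : ∀ c .{{_ : NonZero c}} {a b} → + c ℚ./ suc a ℚ.≤ + c ℚ./ suc b → b ℕ.≤ a
c/suc-cancel-≤ c {a} {b} le = ℕP.≤-pred (ℕP.*-cancelˡ-≤ c (ℤP.drop‿+≤+
  (subst₂ ℤ._≤_ (sym (ℤP.pos-* c (suc b))) (sym (ℤP.pos-* c (suc a))) (/-cancel-≤ (+ c) (+ c) a b le))))

c/suc-pos : ∀ c .{{_ : NonZero c}} a → 0ℚ ℚ.< + c ℚ./ suc a
c/suc-pos (suc c) a = ℚP.≰⇒> (λ le → ℤP.<⇒≱ (ℤ.+<+ (s≤s z≤n)) (/-cancel-≤ (+ suc c) 0ℤ a 0 le))

isOdd : ℕ → Bool
isOdd zero = false
isOdd (suc n) = not (isOdd n)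

isOdd-*2 : ∀ k → isOdd (k * 2) ≡ false
isOdd-*2 zero = refl
isOdd-*2 (suc k) rewrite isOdd-*2 k = refl

reversed : ℕ → Bool
reversed zero = false
reversed (suc n) = isOdd n

Oriented : Bool → ℚ → ℚ → Set
Oriented false x y = x ℚ.< y
Oriented true x y = y ℚ.< x

data IndexView : ℕ → Set where
  origin : IndexView 0
  odd    : ∀ k → IndexView (suc (k * 2))
  even   : ∀ k → IndexView (suc (suc (k * 2)))

indexView : ∀ n → IndexView n
indexView zero = origin
indexView (suc zero) = odd 0
indexView (suc (suc n)) with indexView n
... | origin = even 0
... | odd k = odd (suc k)
... | even k = even (suc k)

LexAt⇒Oriented : ∀ {i x y} → LexAt i x y → Oriented (reversed i) x y
LexAt⇒Oriented (at0 x<y) = x<y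
LexAt⇒Oriented (atOdd {k} x<y) rewrite isOdd-*2 k = x<y
LexAt⇒Oriented (atEven {k} y<x) rewrite isOdd-*2 k = y<x

Oriented⇒LexAt : ∀ i {x y} → Oriented (reversed i) x y → LexAt i x y
Oriented⇒LexAt i o with indexView i
... | origin = at0 o
... | odd k rewrite isOdd-*2 k = atOdd {k} o
... | even k rewrite isOdd-*2 k = atEven {k} o

Oriented-irrefl : ∀ b {x} → ¬ Oriented b x x
Oriented-irrefl false = ℚP.<-irrefl refl
Oriented-irrefl true = ℚP.<-irrefl refl

Oriented-asym : ∀ b {x y} → Oriented b x y → ¬ Oriented b y x
Oriented-asym false = ℚP.<-asym
Oriented-asym true = ℚP.<-asym

Oriented-trans : ∀ b {x y z} → Oriented b x y → Oriented b y z → Oriented b x z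
Oriented-trans false x<y y<z = ℚP.<-trans x<y y<z
Oriented-trans true y<x z<y = ℚP.<-trans z<y y<x

Oriented-cmp : ∀ b x y → Oriented b x y ⊎ x ≡ y ⊎ Oriented b y x
Oriented-cmp b x y with ℚP.<-cmp x y | b
... | tri< x<y _ _ | false = inj₁ x<y
... | tri< x<y _ _ | true = inj₂ (inj₂ x<y)
... | tri≈ _ x≡y _ | _ = inj₂ (inj₁ x≡y)
... | tri> _ _ y<x | false = inj₂ (inj₂ y<x)
... | tri> _ _ y<x | true = inj₁ y<x

LexAt-irrefl : ∀ {i x} → ¬ LexAt i x x
LexAt-irrefl {i} l = Oriented-irrefl (reversed i) (LexAt⇒Oriented l)

LexAt-asym : ∀ {i x y} → LexAt i x y → ¬ LexAt i y x
LexAt-asym {i} l l′ = Oriented-asym (reversed i) (LexAt⇒Oriented l) (LexAt⇒Oriented l′)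

LexAt-trans : ∀ {i x y z} → LexAt i x y → LexAt i y z → LexAt i x z
LexAt-trans {i} l l′ = Oriented⇒LexAt i (Oriented-trans (reversed i) (LexAt⇒Oriented l) (LexAt⇒Oriented l′))

LexAt-cmp : ∀ i x y → LexAt i x y ⊎ x ≡ y ⊎ LexAt i y x
LexAt-cmp i x y with Oriented-cmp (reversed i) x y
... | inj₁ o = inj₁ (Oriented⇒LexAt i o)
... | inj₂ (inj₁ x≡y) = inj₂ (inj₁ x≡y)
... | inj₂ (inj₂ o) = inj₂ (inj₂ (Oriented⇒LexAt i o))

Ascending : ℕ → Set
Ascending i = ∀ {x y} → LexAt i x y → x ℚ.< y

Descending : ℕ → Set
Descending i = ∀ {x y} → LexAt i x y → y ℚ.< x

ascending-origin : Ascending 0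
ascending-origin (at0 x<y) = x<y

ascending-odd : ∀ k → Ascending (suc (k * 2))
ascending-odd k l = subst (λ b → Oriented b _ _) (isOdd-*2 k) (LexAt⇒Oriented l)

descending-even : ∀ k → Descending (suc (suc (k * 2)))
descending-even k l = subst (λ b → Oriented (not b) _ _) (isOdd-*2 k) (LexAt⇒Oriented l)

Agree : Seq → Seq → ℕ → Set
Agree p q k = ∀ j → j ℕ.< k → p j ≡ q j

Agree-sym : ∀ {p q k} → Agree p q k → Agree q p k
Agree-sym ag j j<k = sym (ag j j<k)

Agree-trans : ∀ {p q r k} → Agree p q k → Agree q r k → Agree p r k
Agree-trans ag ag′ j j<k = trans (ag j j<k) (ag′ j j<k)

Agree-≤ : ∀ {p q k n} → k ℕ.≤ n → Agree p q n → Agree p q k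
Agree-≤ k≤n ag j j<k = ag j (ℕP.<-≤-trans j<k k≤n)

Agree-suc : ∀ {p q k} → Agree p q k → p k ≡ q k → Agree p q (suc k)
Agree-suc ag e j j<1+k with ℕP.m≤n⇒m<n∨m≡n (ℕP.≤-pred j<1+k)
... | inj₁ j<k = ag j j<k
... | inj₂ refl = e

≺-asym : ∀ {p q} → p ≺ q → ¬ q ≺ p
≺-asym (i , ag , l) (i′ , ag′ , l′) with ℕP.<-cmp i i′
... | tri< i<i′ _ _ = LexAt-irrefl (subst (LexAt i _) (ag′ i i<i′) l)
... | tri≈ _ refl _ = LexAt-asym l l′
... | tri> _ _ i′<i = LexAt-irrefl (subst (LexAt i′ _) (ag i′ i′<i) l′)

≺⇒≉ : ∀ {p q} → p ≺ q → ¬ p ≈ q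
≺⇒≉ (i , _ , l) p≈q = LexAt-irrefl (subst (LexAt i _) (sym (p≈q i)) l)

≼⇒⊁ : ∀ {p q} → p ≼ q → ¬ q ≺ p
≼⇒⊁ (inj₁ p≺q) = ≺-asym p≺q
≼⇒⊁ (inj₂ p≈q) q≺p = ≺⇒≉ q≺p (λ n → sym (p≈q n))

≺-resp-Agree : ∀ {p q p′ q′} (w : p ≺ q) →
               Agree p p′ (suc (proj₁ w)) → Agree q q′ (suc (proj₁ w)) → p′ ≺ q′
≺-resp-Agree (i , ag , l) agp agq =
  i , Agree-trans (Agree-sym (Agree-≤ (ℕP.n≤1+n i) agp)) (Agree-trans ag (Agree-≤ (ℕP.n≤1+n i) agq)) ,
  subst₂ (LexAt i) (agp i ℕP.≤-refl) (agq i ℕP.≤-refl) l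

≼-origin : ∀ {p q} → p ≼ q → p 0 ℚ.≤ q 0
≼-origin (inj₁ (zero , _ , l)) = ℚP.<⇒≤ (ascending-origin l)
≼-origin (inj₁ (suc i , ag , _)) = ℚP.≤-reflexive (ag 0 (s≤s z≤n))
≼-origin (inj₂ p≈q) = ℚP.≤-reflexive (p≈q 0)

module Classical (em : ExcludedMiddle 0ℓ) where

  dne : {P : Set} → ¬ ¬ P → P
  dne {P} ¬¬p with em {P}
  ... | yes p = p
  ... | no ¬p = ⊥-elim (¬¬p ¬p)

  argmin : {A : Set} (μ : A → ℕ) → A → Σ A λ x → ∀ y → μ x ℕ.≤ μ y
  argmin {A} μ x₀ = descend (suc (μ x₀)) x₀ ℕP.≤-refl
    where
    descend : (fuel : ℕ) → (x : A) → μ x ℕ.< fuel → Σ A λ x → ∀ y → μ x ℕ.≤ μ y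
    descend (suc fuel) x μx<1+fuel with em {Σ A λ y → μ y ℕ.< μ x}
    ... | yes (y , μy<μx) = descend fuel y (ℕP.<-≤-trans μy<μx (ℕP.≤-pred μx<1+fuel))
    ... | no ¬smaller = x , λ y → ℕP.≮⇒≥ (λ μy<μx → ¬smaller (y , μy<μx))

  first-failure : (P : ℕ → Set) → P 0 → ¬ (∀ k → P k) → Σ ℕ λ k → P k × ¬ P (suc k)
  first-failure P p₀ ¬all = descend (proj₁ failure) (proj₂ failure)
    where
    failure : Σ ℕ λ n → ¬ P n
    failure = dne (λ none → ¬all (λ n → dne (λ ¬pn → none (n , ¬pn))))
    descend : ∀ n → ¬ P n → Σ ℕ λ k → P k × ¬ P (suc k)
    descend zero ¬p₀ = ⊥-elim (¬p₀ p₀)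
    descend (suc n) ¬pn+1 with em {P n}
    ... | yes pn = n , pn , ¬pn+1
    ... | no ¬pn = descend n ¬pn

  first-difference : ∀ {p q} → (Σ ℕ λ n → p n ≢ q n) → Σ ℕ λ i → Agree p q i × p i ≢ q i
  first-difference differ with argmin proj₁ differ
  ... | (i , pi≢qi) , least = i , (λ j j<i → dne (λ p≢q → ℕP.<⇒≱ j<i (least (j , p≢q)))) , pi≢qi

  ≺-cmp : ∀ p q → p ≺ q ⊎ p ≈ q ⊎ q ≺ p
  ≺-cmp p q with em {Σ ℕ λ n → p n ≢ q n}
  ... | no ¬differ = inj₂ (inj₁ (λ n → dne (λ p≢q → ¬differ (n , p≢q))))
  ... | yes differ with first-difference differ
  ... | i , agree , pi≢qi with LexAt-cmp i (p i) (q i)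
  ...   | inj₁ l = inj₁ (i , agree , l)
  ...   | inj₂ (inj₁ pi≡qi) = ⊥-elim (pi≢qi pi≡qi)
  ...   | inj₂ (inj₂ l) = inj₂ (inj₂ (i , Agree-sym agree , l))

  ⊁⇒≼ : ∀ {p q} → ¬ q ≺ p → p ≼ q
  ⊁⇒≼ {p} {q} q⊀p with ≺-cmp p q
  ... | inj₁ p≺q = inj₁ p≺q
  ... | inj₂ (inj₁ p≈q) = inj₂ p≈q
  ... | inj₂ (inj₂ q≺p) = ⊥-elim (q⊀p q≺p)

module Members (C : Cseq) where
  open Cseq C

  c≢0 : ∀ n → 1 ℕ.≤ n → NonZero (c n)
  c≢0 n 1≤n = >-nonZero (cpos n 1≤n)

  cOver-anti-≤ : ∀ n {a b} ha hb → b ℕ.≤ a → cOver C n a ha ℚ.≤ cOver C n b hb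
  cOver-anti-≤ n {suc a} {suc b} _ _ (s≤s b≤a) = c/suc-anti-≤ (c n) b≤a

  cOver-cancel-≤ : ∀ n → 1 ℕ.≤ n → ∀ {a b} ha hb → cOver C n a ha ℚ.≤ cOver C n b hb → b ℕ.≤ a
  cOver-cancel-≤ n 1≤n {suc a} {suc b} _ _ le = s≤s (c/suc-cancel-≤ (c n) {{c≢0 n 1≤n}} le)

  cOver-anti-< : ∀ n → 1 ℕ.≤ n → ∀ {a b} ha hb → b ℕ.< a → cOver C n a ha ℚ.< cOver C n b hb
  cOver-anti-< n 1≤n ha hb b<a = ℚP.≰⇒> (λ le → ℕP.<⇒≱ b<a (cOver-cancel-≤ n 1≤n hb ha le))

  cOver-cancel-< : ∀ n → 1 ℕ.≤ n → ∀ {a b} ha hb → cOver C n a ha ℚ.< cOver C n b hb → b ℕ.< a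
  cOver-cancel-< n 1≤n ha hb lt = ℕP.≰⇒> (λ a≤b → ℚ<⇒≱ lt (cOver-anti-≤ n hb ha a≤b))

  cOver-injective : ∀ n → 1 ℕ.≤ n → ∀ {a b} ha hb → cOver C n a ha ≡ cOver C n b hb → a ≡ b
  cOver-injective n 1≤n ha hb e = ℕP.≤-antisym
    (cOver-cancel-≤ n 1≤n hb ha (ℚP.≤-reflexive (sym e))) (cOver-cancel-≤ n 1≤n ha hb (ℚP.≤-reflexive e))

  cOver-cong : ∀ n {a b} ha hb → a ≡ b → cOver C n a ha ≡ cOver C n b hb
  cOver-cong n _ _ refl = refl

  cOver-pos : ∀ n → 1 ℕ.≤ n → ∀ {a} ha → 0ℚ ℚ.< cOver C n a ha
  cOver-pos n 1≤n {suc a} _ = c/suc-pos (c n) {{c≢0 n 1≤n}} a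

  module Member {q : Seq} (sq : InS C q) where

    den : ℕ → ℕ
    den = proj₁ (InS.aseq sq)

    den-witness : Witness C q den
    den-witness = proj₂ (InS.aseq sq)

    den-pos : ∀ n → 1 ℕ.≤ n → 0 ℕ.< den n
    den-pos = Witness.apos den-witness

    entry-den : ∀ n (h : 1 ℕ.≤ n) → q n ≢ 0ℚ → q n ≡ cOver C n (den n) (den-pos n h)
    entry-den = Witness.qval den-witness

    entry-nonneg : ∀ n → 1 ℕ.≤ n → 0ℚ ℚ.≤ q n
    entry-nonneg n 1≤n with q n ℚP.≟ 0ℚ
    ... | yes qn≡0 = ℚP.≤-reflexive (sym qn≡0)
    ... | no qn≢0 = ℚP.<⇒≤ (subst (0ℚ ℚ.<_) (sym (entry-den n 1≤n qn≢0)) (cOver-pos n 1≤n (den-pos n 1≤n)))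

    integer : ℤ
    integer = proj₁ (InS.q0int sq)

    entry0-integer : q 0 ≡ integer ℚ./ 1
    entry0-integer = proj₂ (InS.q0int sq)

    ⊀0 : ∀ {n} → Ascending n → 1 ℕ.≤ n → ¬ LexAt n (q n) 0ℚ
    ⊀0 asc 1≤n l = ℚ<⇒≱ (asc l) (entry-nonneg _ 1≤n)

    0⊀ : ∀ {n} → Descending n → 1 ℕ.≤ n → ¬ LexAt n 0ℚ (q n)
    0⊀ desc 1≤n l = ℚ<⇒≱ (desc l) (entry-nonneg _ 1≤n)

  open Member public

  den-unique : ∀ {q r n} (sq : InS C q) (sr : InS C r) → 1 ℕ.≤ n →
               q n ≡ r n → q n ≢ 0ℚ → den sq n ≡ den sr n
  den-unique {n = n} sq sr 1≤n qn≡rn qn≢0 = cOver-injective n 1≤n (den-pos sq n 1≤n) (den-pos sr n 1≤n)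
    (trans (sym (entry-den sq n 1≤n qn≢0))
      (trans qn≡rn (entry-den sr n 1≤n (λ rn≡0 → qn≢0 (trans qn≡rn rn≡0)))))

  InS-resp-≈ : ∀ {q q′} → InS C q → q ≈ q′ → InS C q′
  InS-resp-≈ {q} {q′} sq q≈q′ = record
    { q0int = integer sq , trans (sym (q≈q′ 0)) (entry0-integer sq)
    ; le1 = λ n h → subst (ℚ._≤ 1ℚ) (q≈q′ n) (InS.le1 sq n h)
    ; one = λ q′1≡1 q′2≡0 → InS.one sq (trans (q≈q′ 1) q′1≡1) (trans (q≈q′ 2) q′2≡0)
    ; zeros = λ m h q′m≡0 n m≤n → trans (sym (q≈q′ n)) (InS.zeros sq m h (trans (q≈q′ m) q′m≡0) n m≤n)
    ; aseq = den sq , record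
        { apos = den-pos sq
        ; agrow = Witness.agrow (den-witness sq)
        ; qval = λ n h q′n≢0 →
            trans (sym (q≈q′ n)) (entry-den sq n h (λ qn≡0 → q′n≢0 (trans (sym (q≈q′ n)) qn≡0)))
        ; strict = λ n h q′n+1≢0 → strict n h
            (Witness.strict (den-witness sq) n h (λ qn+1≡0 → q′n+1≢0 (trans (sym (q≈q′ (suc n))) qn+1≡0)))
        } }
    where
    strict : ∀ n h → q (suc (suc n)) ≢ 0ℚ ⊎ ratio C n h * (den sq n * (den sq n + 1)) ℕ.< den sq (suc n) →
             q′ (suc (suc n)) ≢ 0ℚ ⊎ ratio C n h * (den sq n * (den sq n + 1)) ℕ.< den sq (suc n)
    strict n h (inj₁ qn+2≢0) = inj₁ (λ q′n+2≡0 → qn+2≢0 (trans (q≈q′ _) q′n+2≡0))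
    strict n h (inj₂ grows) = inj₂ grows

  module FiniteSupport (q : Seq) (a : ℕ → ℕ) (K : ℕ)
    (a-pos : ∀ n → 1 ℕ.≤ n → n ℕ.≤ K → 0 ℕ.< a n)
    (q≡cOver : ∀ n (h : 1 ℕ.≤ n) (n≤K : n ℕ.≤ K) → q n ≡ cOver C n (a n) (a-pos n h n≤K))
    (q-vanishes : ∀ n → K ℕ.< n → q n ≡ 0ℚ)
    (a-grows : ∀ n (h : 1 ℕ.≤ n) → suc n ℕ.≤ K → ratio C n h * (a n * (a n + 1)) ℕ.≤ a (suc n))
    (a-strict : ∀ n (h : 1 ℕ.≤ n) → suc n ≡ K → ratio C n h * (a n * (a n + 1)) ℕ.< a (suc n))
    where

    -- beyond K the growth condition holds because ratio C n h ≤ c (suc n)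
    extended : ℕ → ℕ
    extended zero = 1
    extended (suc n) with suc n ℕP.≤? K
    ... | yes _ = a (suc n)
    ... | no _ = suc (c (suc n) * (extended n * (extended n + 1)))

    extended-≤K : ∀ n → 1 ℕ.≤ n → n ℕ.≤ K → extended n ≡ a n
    extended-≤K (suc n) _ n+1≤K with suc n ℕP.≤? K
    ... | yes _ = refl
    ... | no n+1≰K = ⊥-elim (n+1≰K n+1≤K)

    extended-pos : ∀ n → 0 ℕ.< extended n
    extended-pos zero = s≤s z≤n
    extended-pos (suc n) with suc n ℕP.≤? K
    ... | yes n+1≤K = a-pos (suc n) (s≤s z≤n) n+1≤K
    ... | no _ = s≤s z≤n

    q≢0 : ∀ n → 1 ℕ.≤ n → n ℕ.≤ K → q n ≢ 0ℚ
    q≢0 n h n≤K qn≡0 = ℚP.<-irrefl (sym (trans (sym (q≡cOver n h n≤K)) qn≡0)) (cOver-pos n h (a-pos n h n≤K))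

    witness : Witness C q extended
    Witness.apos witness n _ = extended-pos n
    Witness.agrow witness n h with suc n ℕP.≤? K
    ... | yes n+1≤K rewrite extended-≤K n h (ℕP.<⇒≤ n+1≤K) = a-grows n h n+1≤K
    ... | no n+1≰K =
      ℕP.m≤n⇒m≤1+n (ℕP.*-monoˡ-≤ (extended n * (extended n + 1)) (DivMod.m/n≤m (c (suc n)) (c n) {{c≢0 n h}}))
    Witness.qval witness n h qn≢0 with n ℕP.≤? K
    ... | yes n≤K =
      trans (q≡cOver n h n≤K) (cOver-cong n (a-pos n h n≤K) (extended-pos n) (sym (extended-≤K n h n≤K)))
    ... | no n≰K = ⊥-elim (qn≢0 (q-vanishes n (ℕP.≰⇒> n≰K)))
    Witness.strict witness n h qn+1≢0 with suc n ℕP.≤? K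
    ... | no n+1≰K = ⊥-elim (qn+1≢0 (q-vanishes (suc n) (ℕP.≰⇒> n+1≰K)))
    ... | yes n+1≤K with suc (suc n) ℕP.≤? K
    ...   | yes n+2≤K = inj₁ (q≢0 (suc (suc n)) (s≤s z≤n) n+2≤K)
    ...   | no n+2≰K rewrite extended-≤K n h (ℕP.<⇒≤ n+1≤K) =
              inj₂ (a-strict n h (ℕP.≤-antisym n+1≤K (ℕP.≮⇒≥ n+2≰K)))

    InS-finite : (∃[ z ] q 0 ≡ z ℚ./ 1) → (∀ n → 1 ℕ.≤ n → n ℕ.≤ K → q n ℚ.≤ 1ℚ) → (K ≡ 1 → q 1 ≢ 1ℚ) →
                 InS C q
    InS.q0int (InS-finite q0 _ _) = q0
    InS.le1 (InS-finite _ q≤1 _) n h with n ℕP.≤? K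
    ... | yes n≤K = q≤1 n h n≤K
    ... | no n≰K = subst (ℚ._≤ 1ℚ) (sym (q-vanishes n (ℕP.≰⇒> n≰K))) 0≤1
    InS.one (InS-finite _ _ K≢1) q1≡1 with ℕP.<-cmp K 1
    ... | tri< K<1 _ _ = λ _ → 0≢1 (trans (sym (q-vanishes 1 K<1)) q1≡1)
    ... | tri≈ _ K≡1 _ = ⊥-elim (K≢1 K≡1 q1≡1)
    ... | tri> _ _ 1<K = q≢0 2 (s≤s z≤n) 1<K
    InS.zeros (InS-finite _ _ _) m h qm≡0 n m≤n with m ℕP.≤? K
    ... | yes m≤K = ⊥-elim (q≢0 m h m≤K qm≡0)
    ... | no m≰K = q-vanishes n (ℕP.<-≤-trans (ℕP.≰⇒> m≰K) m≤n)
    InS.aseq (InS-finite _ _ _) = extended , witness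

module _ (em : ExcludedMiddle 0ℓ) (C : Cseq) where
  open Classical em
  open Members C

  module Closure {q : Seq} (approx : ∀ n → Σ Seq λ r → InS C r × Agree r q (suc n)) where
    r : ℕ → Seq
    r n = proj₁ (approx n)

    r∈S : ∀ n → InS C (r n)
    r∈S n = proj₁ (proj₂ (approx n))

    r-agrees : ∀ n → Agree (r n) q (suc n)
    r-agrees n = proj₂ (proj₂ (approx n))

    r-diag : ∀ n → r n n ≡ q n
    r-diag n = r-agrees n n ℕP.≤-refl

    InS-closed : InS C q
    InS-closed with em {Σ ℕ λ z → 1 ℕ.≤ z × q z ≡ 0ℚ}
    ... | yes (z , 1≤z , qz≡0) = InS-resp-≈ (r∈S z) rz≈q
      where
      q-vanishes : ∀ m → z ℕ.≤ m → q m ≡ 0ℚ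
      q-vanishes m z≤m =
        trans (sym (r-diag m)) (InS.zeros (r∈S m) z 1≤z (trans (r-agrees m z (s≤s z≤m)) qz≡0) m z≤m)
      rz-vanishes : ∀ m → z ℕ.≤ m → r z m ≡ 0ℚ
      rz-vanishes m z≤m = InS.zeros (r∈S z) z 1≤z (trans (r-diag z) qz≡0) m z≤m
      rz≈q : r z ≈ q
      rz≈q m with m ℕP.≤? z
      ... | yes m≤z = r-agrees z m (s≤s m≤z)
      ... | no m≰z = trans (rz-vanishes m z≤m) (sym (q-vanishes m z≤m))
        where
        z≤m : z ℕ.≤ m
        z≤m = ℕP.<⇒≤ (ℕP.≰⇒> m≰z)
    ... | no no-zero = record
      { q0int = integer (r∈S 0) , trans (sym (r-diag 0)) (entry0-integer (r∈S 0))
      ; le1 = λ n h → subst (ℚ._≤ 1ℚ) (r-diag n) (InS.le1 (r∈S n) n h)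
      ; one = λ _ q2≡0 → no-zero (2 , s≤s z≤n , q2≡0)
      ; zeros = λ m h qm≡0 → ⊥-elim (no-zero (m , h , qm≡0))
      ; aseq = a , witness
      }
      where
      q≢0 : ∀ n → 1 ℕ.≤ n → q n ≢ 0ℚ
      q≢0 n h qn≡0 = no-zero (n , h , qn≡0)
      a : ℕ → ℕ
      a n = den (r∈S n) n
      den-agrees : ∀ m n → 1 ℕ.≤ n → n ℕ.≤ m → den (r∈S m) n ≡ a n
      den-agrees m n h n≤m = den-unique (r∈S m) (r∈S n) h (trans (r-agrees m n (s≤s n≤m)) (sym (r-diag n)))
        (λ rmn≡0 → q≢0 n h (trans (sym (r-agrees m n (s≤s n≤m))) rmn≡0))
      witness : Witness C q a
      Witness.apos witness n h = den-pos (r∈S n) n h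
      Witness.agrow witness n h = subst (λ x → ratio C n h * (x * (x + 1)) ℕ.≤ a (suc n))
        (den-agrees (suc n) n h (ℕP.n≤1+n n)) (Witness.agrow (den-witness (r∈S (suc n))) n h)
      Witness.qval witness n h qn≢0 =
        trans (sym (r-diag n)) (entry-den (r∈S n) n h (λ rnn≡0 → qn≢0 (trans (sym (r-diag n)) rnn≡0)))
      Witness.strict witness n h _ = inj₁ (q≢0 (suc (suc n)) (s≤s z≤n))

module Supremum (em : ExcludedMiddle 0ℓ) (C : Cseq) (M : Seq → Set) (M⊆S : ∀ q → M q → InS C q)
                (m₀ : Seq) (m₀∈M : M m₀) (u : Seq) (u∈S : InS C u) (u-ub : ∀ q → M q → q ≼ u) where
  open Classical em
  open Members C

  Candidate : Seq → ℕ → Seq → Set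
  Candidate f k q = M q × Agree q f k

  Optimal : Seq → ℕ → Seq → Set
  Optimal f k q = Candidate f k q × (∀ q′ → Candidate f k q′ → ¬ LexAt k (q k) (q′ k))

  -- s k is the k-th entry of an optimal candidate if there is one and 0 otherwise; prefix k is s below k,
  -- through which s is defined by recursion on k
  chooseFrom : ∀ f k → Dec (Σ Seq (Optimal f k)) → ℚ
  chooseFrom f k (yes (q , _)) = q k
  chooseFrom f k (no _) = 0ℚ

  choose : Seq → ℕ → ℚ
  choose f k = chooseFrom f k em

  prefix : ℕ → Seq
  prefix zero _ = 0ℚ
  prefix (suc k) j with j ℕP.<? k
  ... | yes _ = prefix k j
  ... | no _ = choose (prefix k) k

  s : Seq
  s k = choose (prefix k) k

  prefix-agrees : ∀ k → Agree (prefix k) s k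
  prefix-agrees (suc k) j j<1+k with j ℕP.<? k
  ... | yes j<k = prefix-agrees k j j<k
  ... | no j≮k with ℕP.≤-antisym (ℕP.≤-pred j<1+k) (ℕP.≮⇒≥ j≮k)
  ...   | refl = refl

  toPrefix : ∀ {k q} → Candidate s k q → Candidate (prefix k) k q
  toPrefix {k} (q∈M , ag) = q∈M , Agree-trans ag (Agree-sym (prefix-agrees k))

  fromPrefix : ∀ {k q} → Candidate (prefix k) k q → Candidate s k q
  fromPrefix {k} (q∈M , ag) = q∈M , Agree-trans ag (prefix-agrees k)

  chosen : ∀ k → Σ Seq (Optimal (prefix k) k) → Σ Seq λ q → Optimal (prefix k) k q × s k ≡ q k
  chosen k optimum with em {Σ Seq (Optimal (prefix k) k)}
  ... | yes (q , q-opt) = q , q-opt , refl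
  ... | no none = ⊥-elim (none optimum)

  unchosen : ∀ k → ¬ Σ Seq (Optimal (prefix k) k) → s k ≡ 0ℚ
  unchosen k none with em {Σ Seq (Optimal (prefix k) k)}
  ... | yes optimum = ⊥-elim (none optimum)
  ... | no _ = refl

  Reached : ℕ → Set
  Reached k = Σ Seq (Candidate s k)

  Maximal : ℕ → Set
  Maximal k = ∀ q → Candidate s k q → ¬ LexAt k (s k) (q k)

  optimal⇒maximal : ∀ k → Σ Seq (Optimal (prefix k) k) → Maximal k × Reached (suc k)
  optimal⇒maximal k optimum with chosen k optimum
  ... | q , ((q∈M , ag) , unbeaten) , sk≡qk =
    (λ q′ c′ l → unbeaten q′ (toPrefix c′) (subst (λ x → LexAt k x (q′ k)) sk≡qk l)) ,
    q , q∈M , Agree-suc (Agree-trans ag (prefix-agrees k)) (sym sk≡qk)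

  reached-0 : Reached 0
  reached-0 = m₀ , m₀∈M , λ _ ()

  Reached-≤ : ∀ {k n} → k ℕ.≤ n → Reached n → Reached k
  Reached-≤ k≤n (q , q∈M , ag) = q , q∈M , Agree-≤ k≤n ag

  integer-bounded : ∀ q (q∈M : M q) → integer (M⊆S q q∈M) ℤ.≤ integer u∈S
  integer-bounded q q∈M = /1-cancel-≤ _ _
    (subst₂ ℚ._≤_ (entry0-integer (M⊆S q q∈M)) (entry0-integer u∈S) (≼-origin (u-ub q q∈M)))

  optimal-origin : Σ Seq (Optimal (prefix 0) 0)
  optimal-origin with argmin (λ (x : Σ Seq M) → ℤ.∣ integer u∈S ℤ.- integer (M⊆S _ (proj₂ x)) ∣)
                             (m₀ , m₀∈M)
  ... | (q , q∈M) , closest = q , (q∈M , λ _ ()) , unbeaten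
    where
    unbeaten : ∀ q′ → Candidate (prefix 0) 0 q′ → ¬ LexAt 0 (q 0) (q′ 0)
    unbeaten q′ (q′∈M , _) l = ℚ<⇒≱ (ascending-origin l)
      (subst₂ ℚ._≤_ (sym (entry0-integer (M⊆S q′ q′∈M))) (sym (entry0-integer (M⊆S q q∈M)))
        (/1-mono-≤ (∣w-z∣≤∣w-z′∣⇒z′≤z (integer-bounded q q∈M) (integer-bounded q′ q′∈M)
          (closest (q′ , q′∈M)))))

  -- the largest nonzero entry c n / a is the one with the least denominator a
  optimal-ascending : ∀ n → 1 ℕ.≤ n → Ascending n → Reached n → Σ Seq (Optimal (prefix n) n)
  optimal-ascending n 1≤n asc (q₀ , c₀) with em {Σ Seq λ q → Candidate s n q × q n ≢ 0ℚ}
  ... | no all-zero = q₀ , toPrefix c₀ , λ q′ c′ l →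
    LexAt-irrefl (subst₂ (LexAt n) (vanishes q₀ c₀) (vanishes q′ (fromPrefix c′)) l)
    where
    vanishes : ∀ q → Candidate s n q → q n ≡ 0ℚ
    vanishes q c = dne (λ qn≢0 → all-zero (q , c , qn≢0))
  ... | yes nonzero with argmin (λ x → den (M⊆S _ (proj₁ (proj₁ (proj₂ x)))) n) nonzero
  ...   | (q , (q∈M , ag) , qn≢0) , least = q , toPrefix (q∈M , ag) , unbeaten
    where
    unbeaten : ∀ q′ → Candidate (prefix n) n q′ → ¬ LexAt n (q n) (q′ n)
    unbeaten q′ c′ l with q′ n ℚP.≟ 0ℚ
    ... | yes q′n≡0 = ⊀0 (M⊆S q q∈M) asc 1≤n (subst (LexAt n (q n)) q′n≡0 l)
    ... | no q′n≢0 = ℚ<⇒≱ (asc l) (subst₂ ℚ._≤_ (sym (entry-den q′∈S n 1≤n q′n≢0)) (sym (entry-den q∈S n 1≤n qn≢0))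
          (cOver-anti-≤ n (den-pos q′∈S n 1≤n) (den-pos q∈S n 1≤n) (least (q′ , fromPrefix c′ , q′n≢0))))
      where
      q∈S : InS C q
      q∈S = M⊆S q q∈M
      q′∈S : InS C q′
      q′∈S = M⊆S q′ (proj₁ c′)

  zero-optimal-descending : ∀ n → 1 ℕ.≤ n → Descending n →
                            ∀ q → Candidate s n q → q n ≡ 0ℚ → Optimal (prefix n) n q
  zero-optimal-descending n 1≤n desc q c qn≡0 =
    toPrefix c , λ q′ c′ l → 0⊀ (M⊆S q′ (proj₁ c′)) desc 1≤n (subst (λ x → LexAt n x (q′ n)) qn≡0 l)

  -- at an even index an optimum can only be missing when s k = 0, but the next reached candidate then has entry 0
  optimum-exists : ∀ k → Reached k → Reached (suc k) → Σ Seq (Optimal (prefix k) k)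
  optimum-exists k r _ with indexView k
  ... | origin = optimal-origin
  ... | odd j = optimal-ascending _ (s≤s z≤n) (ascending-odd j) r
  optimum-exists k _ (q , q∈M , ag) | even j = dne λ none →
    none (q , zero-optimal-descending k (s≤s z≤n) (descending-even j) q (q∈M , Agree-≤ (ℕP.n≤1+n k) ag)
                (trans (ag k ℕP.≤-refl) (unchosen k none)))

  maximal : ∀ k → Reached k → Reached (suc k) → Maximal k
  maximal k r r′ = proj₁ (optimal⇒maximal k (optimum-exists k r r′))

  module AllReached (reached : ∀ k → Reached k) where

    s-ub : ∀ q → M q → q ≼ s
    s-ub q q∈M = ⊁⇒≼ λ (i , ag , l) → maximal i (reached i) (reached (suc i)) q (q∈M , Agree-sym ag) l

    s-least : ∀ v → IsUpperBound C M v → s ≼ v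
    s-least v (_ , v-ub) = ⊁⇒≼ λ v≺s →
      let (q , q∈M , ag) = reached (suc (proj₁ v≺s))
      in ≼⇒⊁ (v-ub q q∈M) (≺-resp-Agree v≺s (λ _ _ → refl) (Agree-sym ag))

    s∈S : InS C s
    s∈S = Closure.InS-closed em C λ n → let (q , q∈M , ag) = reached (suc n) in q , M⊆S q q∈M , ag

    s-sup : ∃[ w ] IsSup C M w
    s-sup = s , (s∈S , s-ub) , s-least

  module Stuck (j : ℕ) (reached-k : Reached (suc (suc (j * 2))))
               (¬reached : ¬ Reached (suc (suc (suc (j * 2))))) where

    J K k : ℕ
    J = j * 2
    K = suc J
    k = suc K

    1≤K : 1 ℕ.≤ K
    1≤K = s≤s z≤n

    1≤k : 1 ℕ.≤ k
    1≤k = s≤s z≤n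

    no-optimum : ¬ Σ Seq (Optimal (prefix k) k)
    no-optimum optimum = ¬reached (proj₂ (optimal⇒maximal k optimum))

    candidate-nonzero : ∀ q → Candidate s k q → q k ≢ 0ℚ
    candidate-nonzero q c qk≡0 = no-optimum (q , zero-optimal-descending k 1≤k (descending-even j) q c qk≡0)

    den-k : ∀ {q} → Candidate s k q → ℕ
    den-k {q} c = den (M⊆S q (proj₁ c)) k

    den-k-pos : ∀ {q} (c : Candidate s k q) → 0 ℕ.< den-k c
    den-k-pos {q} c = den-pos (M⊆S q (proj₁ c)) k 1≤k

    candidate-den : ∀ q (c : Candidate s k q) → q k ≡ cOver C k (den-k c) (den-k-pos c)
    candidate-den q c = entry-den (M⊆S q (proj₁ c)) k 1≤k (candidate-nonzero q c)

    -- otherwise the candidate with the largest denominator, which is at most b, would be optimal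
    no-positive-lower-bound : ∀ {b} (hb : 0 ℕ.< b) → ¬ (∀ q → Candidate s k q → cOver C k b hb ℚ.≤ q k)
    no-positive-lower-bound {b} hb bound with argmin (λ x → b ∸ den-k (proj₂ x)) reached-k
    ... | (q , c) , least = no-optimum (q , toPrefix c , unbeaten)
      where
      den≤b : ∀ q (c : Candidate s k q) → den-k c ℕ.≤ b
      den≤b q c = cOver-cancel-≤ k 1≤k hb (den-k-pos c)
        (subst (cOver C k b hb ℚ.≤_) (candidate-den q c) (bound q c))
      unbeaten : ∀ q′ → Candidate (prefix k) k q′ → ¬ LexAt k (q k) (q′ k)
      unbeaten q′ c′ l = ℚ<⇒≱ (descending-even j l)
        (subst₂ ℚ._≤_ (sym (candidate-den q c)) (sym (candidate-den q′ c″))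
          (cOver-anti-≤ k (den-k-pos c) (den-k-pos c″) (ℕP.∸-cancelʳ-≤ (den≤b q′ c″) (least (q′ , c″)))))
        where
        c″ : Candidate s k q′
        c″ = fromPrefix c′

    m₁ : Seq
    m₁ = proj₁ reached-k

    m₁∈M : M m₁
    m₁∈M = proj₁ (proj₂ reached-k)

    m₁∈S : InS C m₁
    m₁∈S = M⊆S m₁ m₁∈M

    m₁-agrees : Agree m₁ s k
    m₁-agrees = proj₂ (proj₂ reached-k)

    a : ℕ → ℕ
    a = den m₁∈S

    s-nonzero : ∀ i → 1 ℕ.≤ i → i ℕ.≤ K → s i ≢ 0ℚ
    s-nonzero i h i≤K si≡0 = candidate-nonzero m₁ (m₁∈M , m₁-agrees)
      (InS.zeros m₁∈S i h (trans (m₁-agrees i (s≤s i≤K)) si≡0) k (ℕP.m≤n⇒m≤1+n i≤K))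

    s-den : ∀ i (h : 1 ℕ.≤ i) → i ℕ.≤ K → s i ≡ cOver C i (a i) (den-pos m₁∈S i h)
    s-den i h i≤K = trans (sym (m₁-agrees i (s≤s i≤K)))
      (entry-den m₁∈S i h (λ m₁i≡0 → s-nonzero i h i≤K (trans (sym (m₁-agrees i (s≤s i≤K))) m₁i≡0)))

    den-s : ∀ {v} (v∈S : InS C v) i → 1 ℕ.≤ i → i ℕ.≤ K → v i ≡ s i → den v∈S i ≡ a i
    den-s v∈S i h i≤K vi≡si = den-unique v∈S m₁∈S h (trans vi≡si (sym (m₁-agrees i (s≤s i≤K))))
      (λ vi≡0 → s-nonzero i h i≤K (trans (sym vi≡si) vi≡0))

    s-≤1 : ∀ i → 1 ℕ.≤ i → i ℕ.≤ K → s i ℚ.≤ 1ℚ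
    s-≤1 i h i≤K = subst (ℚ._≤ 1ℚ) (m₁-agrees i (s≤s i≤K)) (InS.le1 m₁∈S i h)

    s-integer : s 0 ≡ integer m₁∈S ℚ./ 1
    s-integer = trans (sym (m₁-agrees 0 (s≤s z≤n))) (entry0-integer m₁∈S)

    -- an upper bound v is ≽ every candidate, so a nonzero v k = c k / b would bound them below
    ub-vanishes : ∀ {v} → IsUpperBound C M v → Agree v s k → v k ≡ 0ℚ
    ub-vanishes {v} (v∈S , v-ub) v-agrees with v k ℚP.≟ 0ℚ
    ... | yes vk≡0 = vk≡0
    ... | no vk≢0 = ⊥-elim (no-positive-lower-bound (den-pos v∈S k 1≤k) bound)
      where
      bound : ∀ q → Candidate s k q → cOver C k _ (den-pos v∈S k 1≤k) ℚ.≤ q k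
      bound q (q∈M , q-agrees) = subst (ℚ._≤ q k) (entry-den v∈S k 1≤k vk≢0) (ℚP.≮⇒≥ λ qk<vk →
        ≼⇒⊁ (v-ub q q∈M) (k , Agree-trans v-agrees (Agree-sym q-agrees) , atEven {j} qk<vk))

    s-unbeaten-below-k : ∀ {q} → M q → (s≺q : s ≺ q) → proj₁ s≺q ℕ.< k → ⊥
    s-unbeaten-below-k {q} q∈M (i , ag , l) i<k =
      maximal i (Reached-≤ (ℕP.<⇒≤ i<k) reached-k) (Reached-≤ i<k reached-k) q (q∈M , Agree-sym ag) l

    ub-unbeaten-below-k : ∀ {v} → IsUpperBound C M v → (v≺s : v ≺ s) → proj₁ v≺s ℕ.< k → ⊥
    ub-unbeaten-below-k (_ , v-ub) v≺s i<k =
      ≼⇒⊁ (v-ub m₁ m₁∈M) (≺-resp-Agree v≺s (λ _ _ → refl) (Agree-sym (Agree-≤ i<k m₁-agrees)))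

    -- the conditions of S on a sequence whose last nonzero entry sits at K
    module Truncation (s1≢1 : j ≡ 0 → s 1 ≢ 1ℚ)
                      (strict : ∀ (h : 1 ℕ.≤ J) → ratio C J h * (a J * (a J + 1)) ℕ.< a K) where

      t : Seq
      t i with i ℕP.≤? K
      ... | yes _ = s i
      ... | no _ = 0ℚ

      t-≤K : ∀ i → i ℕ.≤ K → t i ≡ s i
      t-≤K i i≤K with i ℕP.≤? K
      ... | yes _ = refl
      ... | no i≰K = ⊥-elim (i≰K i≤K)

      t->K : ∀ i → K ℕ.< i → t i ≡ 0ℚ
      t->K i K<i with i ℕP.≤? K
      ... | yes i≤K = ⊥-elim (ℕP.<⇒≱ K<i i≤K)
      ... | no _ = refl

      t-agrees : Agree t s k
      t-agrees i i<k = t-≤K i (ℕP.≤-pred i<k)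

      t∈S : InS C t
      t∈S = FiniteSupport.InS-finite t a K (λ i h _ → den-pos m₁∈S i h)
        (λ i h i≤K → trans (t-≤K i i≤K) (s-den i h i≤K)) t->K
        (λ i h _ → Witness.agrow (den-witness m₁∈S) i h) strict′
        (integer m₁∈S , trans (t-≤K 0 z≤n) s-integer)
        (λ i h i≤K → subst (ℚ._≤ 1ℚ) (sym (t-≤K i i≤K)) (s-≤1 i h i≤K))
        (λ K≡1 t1≡1 → s1≢1 (j≡0 j K≡1) (trans (sym (t-≤K 1 (s≤s z≤n))) t1≡1))
        where
        strict′ : ∀ i (h : 1 ℕ.≤ i) → suc i ≡ K → ratio C i h * (a i * (a i + 1)) ℕ.< a (suc i)
        strict′ _ h refl = strict h
        j≡0 : ∀ j → suc (j * 2) ≡ 1 → j ≡ 0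
        j≡0 zero _ = refl
        j≡0 (suc _) ()

      t-ub : ∀ q → M q → q ≼ t
      t-ub q q∈M = ⊁⇒≼ beaten
        where
        beaten : t ≺ q → ⊥
        beaten t≺q@(i , ag , l) with ℕP.<-cmp i k
        ... | tri< i<k _ _ = s-unbeaten-below-k q∈M (≺-resp-Agree t≺q (Agree-≤ i<k t-agrees) (λ _ _ → refl)) i<k
        ... | tri≈ _ refl _ =
          0⊀ (M⊆S q q∈M) (descending-even j) 1≤k (subst (λ x → LexAt k x (q k)) (t->K k ℕP.≤-refl) l)
        ... | tri> _ _ k<i = candidate-nonzero q (q∈M , Agree-trans (Agree-sym (Agree-≤ (ℕP.<⇒≤ k<i) ag)) t-agrees)
                               (trans (sym (ag k k<i)) (t->K k ℕP.≤-refl))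

      t-least : ∀ v → IsUpperBound C M v → t ≼ v
      t-least v v-ub = ⊁⇒≼ beaten
        where
        beaten : v ≺ t → ⊥
        beaten v≺t@(i , ag , l) with ℕP.<-cmp i k
        ... | tri< i<k _ _ = ub-unbeaten-below-k v-ub (≺-resp-Agree v≺t (λ _ _ → refl) (Agree-≤ i<k t-agrees)) i<k
        ... | tri≈ _ refl _ =
          LexAt-irrefl (subst₂ (LexAt k) (ub-vanishes v-ub (Agree-trans ag t-agrees)) (t->K k ℕP.≤-refl) l)
        ... | tri> _ _ k<i = LexAt-irrefl (subst₂ (LexAt i)
          (InS.zeros (proj₁ v-ub) k 1≤k (trans (ag k k<i) (t->K k ℕP.≤-refl)) i (ℕP.<⇒≤ k<i))
          (t->K i (ℕP.<-trans (ℕP.n<1+n K) k<i)) l)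

      t-sup : ∃[ w ] IsSup C M w
      t-sup = t , (t∈S , t-ub) , t-least

    -- the supremum when the truncation is not in S: p follows s below J and then jumps just past s J
    module Jump (p : Seq) (p∈S : InS C p) (p-agrees : Agree p s J) (s≺p-at-J : LexAt J (s J) (p J))
                (p-vanishes : ∀ i → J ℕ.< i → p i ≡ 0ℚ)
                (nothing-between : ∀ {v} → InS C v → LexAt J (v J) (p J) → ¬ LexAt J (v J) (s J) → v J ≡ s J)
                (s-extreme-at-K : ∀ {v} → InS C v → Agree v s K → ¬ LexAt K (s K) (v K))
                (no-zero-completion : ∀ {v} → InS C v → Agree v s k → v k ≢ 0ℚ) where

      J<k : J ℕ.< k
      J<k = ℕP.<-trans (ℕP.n<1+n J) (ℕP.n<1+n K)

      p-ub : ∀ q → M q → q ≼ p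
      p-ub q q∈M = ⊁⇒≼ beaten
        where
        beaten : p ≺ q → ⊥
        beaten p≺q@(i , ag , l) with ℕP.<-cmp i J
        ... | tri< i<J _ _ =
          s-unbeaten-below-k q∈M (≺-resp-Agree p≺q (Agree-≤ i<J p-agrees) (λ _ _ → refl)) (ℕP.<-trans i<J J<k)
        ... | tri≈ _ refl _ =
          s-unbeaten-below-k q∈M (J , Agree-trans (Agree-sym p-agrees) ag , LexAt-trans s≺p-at-J l) J<k
        ... | tri> _ _ J<i = s-unbeaten-below-k q∈M (J , Agree-trans (Agree-sym p-agrees) (Agree-≤ (ℕP.<⇒≤ J<i) ag) ,
                                                      subst (LexAt J (s J)) (ag J J<i) s≺p-at-J) J<k

      p-least : ∀ v → IsUpperBound C M v → p ≼ v
      p-least v v-ub@(v∈S , _) = ⊁⇒≼ beaten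
        where
        beaten : v ≺ p → ⊥
        beaten v≺p@(i , ag , l) with ℕP.<-cmp i J
        ... | tri< i<J _ _ =
          ub-unbeaten-below-k v-ub (≺-resp-Agree v≺p (λ _ _ → refl) (Agree-≤ i<J p-agrees)) (ℕP.<-trans i<J J<k)
        ... | tri≈ _ refl _ = no-zero-completion v∈S agree-k (ub-vanishes v-ub agree-k)
          where
          agree-J : Agree v s J
          agree-J = Agree-trans ag p-agrees
          agree-K : Agree v s K
          agree-K = Agree-suc agree-J
            (nothing-between v∈S l (λ l′ → ub-unbeaten-below-k v-ub (J , agree-J , l′) J<k))
          vK≡sK : v K ≡ s K
          vK≡sK with LexAt-cmp K (v K) (s K)
          ... | inj₁ l′ = ⊥-elim (ub-unbeaten-below-k v-ub (K , agree-K , l′) (ℕP.n<1+n K))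
          ... | inj₂ (inj₁ vK≡sK) = vK≡sK
          ... | inj₂ (inj₂ l′) = ⊥-elim (s-extreme-at-K v∈S agree-K l′)
          agree-k : Agree v s k
          agree-k = Agree-suc agree-K vK≡sK
        ... | tri> _ _ J<i with ℕP.m≤n⇒m<n∨m≡n J<i
        ...   | inj₂ refl = ⊀0 v∈S (ascending-odd j) 1≤K (subst (LexAt K (v K)) (p-vanishes K (ℕP.n<1+n J)) l)
        ...   | inj₁ K<i = LexAt-irrefl (subst₂ (LexAt i)
          (InS.zeros v∈S K 1≤K (trans (ag K K<i) (p-vanishes K (ℕP.n<1+n J))) i (ℕP.<⇒≤ K<i)) (p-vanishes i J<i) l)

      p-sup : ∃[ w ] IsSup C M w
      p-sup = p , (p∈S , p-ub) , p-least

  module IntegerJump (reached-2 : Reached 2) (¬reached-3 : ¬ Reached 3) (s1≡1 : s 1 ≡ 1ℚ) where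
    open Stuck 0 reached-2 ¬reached-3

    p : Seq
    p zero = ℤ.suc (integer m₁∈S) ℚ./ 1
    p (suc _) = 0ℚ

    p-vanishes : ∀ n → 0 ℕ.< n → p n ≡ 0ℚ
    p-vanishes (suc _) _ = refl

    p∈S : InS C p
    p∈S = FiniteSupport.InS-finite p (λ _ → 1) 0 (λ { (suc _) _ () }) (λ { (suc _) _ () })
      p-vanishes (λ _ _ ()) (λ _ _ ()) (ℤ.suc (integer m₁∈S) , refl) (λ { (suc _) _ () }) (λ ())

    nothing-between : ∀ {v} → InS C v → LexAt 0 (v 0) (p 0) → ¬ LexAt 0 (v 0) (s 0) → v 0 ≡ s 0
    nothing-between v∈S v0<p0 v0≮s0 = ℚP.≤-antisym
      (subst₂ ℚ._≤_ (sym (entry0-integer v∈S)) (sym s-integer)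
        (/1-mono-≤ (/1<suc/1⇒≤ (integer v∈S) (integer m₁∈S)
          (subst (ℚ._< p 0) (entry0-integer v∈S) (ascending-origin v0<p0)))))
      (ℚP.≮⇒≥ (v0≮s0 ∘ at0))

    s1-extreme : ∀ {v} → InS C v → Agree v s 1 → ¬ LexAt 1 (s 1) (v 1)
    s1-extreme {v} v∈S _ l = ℚ<⇒≱ (subst (ℚ._< v 1) s1≡1 (ascending-odd 0 l)) (InS.le1 v∈S 1 (s≤s z≤n))

    no-zero-completion : ∀ {v} → InS C v → Agree v s 2 → v 2 ≢ 0ℚ
    no-zero-completion v∈S v-agrees = InS.one v∈S (trans (v-agrees 1 (s≤s (s≤s z≤n))) s1≡1)

    s≺p-at-0 : LexAt 0 (s 0) (p 0)
    s≺p-at-0 = at0 (subst (ℚ._< p 0) (sym s-integer) (/1<suc/1 (integer m₁∈S)))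

    open Jump p p∈S (λ _ ()) s≺p-at-0 p-vanishes nothing-between s1-extreme no-zero-completion public

  module DenominatorJump (i : ℕ) (reached-k : Reached (suc (suc (suc i * 2))))
                         (¬reached : ¬ Reached (suc (suc (suc (suc i * 2))))) where
    open Stuck (suc i) reached-k ¬reached

    1≤J : 1 ℕ.≤ J
    1≤J = s≤s z≤n

    module _ (not-strict : ¬ ratio C J 1≤J * (a J * (a J + 1)) ℕ.< a K) where

      aK≤growth : a K ℕ.≤ ratio C J 1≤J * (a J * (a J + 1))
      aK≤growth = ℕP.≮⇒≥ not-strict

      bumped : ℕ → ℕ
      bumped n with n ℕP.≟ J
      ... | yes _ = suc (a J)
      ... | no _ = a n

      bumped-<J : ∀ n → n ℕ.< J → bumped n ≡ a n
      bumped-<J n n<J with n ℕP.≟ J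
      ... | yes n≡J = ⊥-elim (ℕP.<⇒≢ n<J n≡J)
      ... | no _ = refl

      bumped-J : bumped J ≡ suc (a J)
      bumped-J with J ℕP.≟ J
      ... | yes _ = refl
      ... | no J≢J = ⊥-elim (J≢J refl)

      cJ : ℚ
      cJ = cOver C J (suc (a J)) (s≤s z≤n)

      p : Seq
      p n with ℕP.<-cmp n J
      ... | tri< _ _ _ = s n
      ... | tri≈ _ _ _ = cJ
      ... | tri> _ _ _ = 0ℚ

      p-<J : ∀ n → n ℕ.< J → p n ≡ s n
      p-<J n n<J with ℕP.<-cmp n J
      ... | tri< _ _ _ = refl
      ... | tri≈ n≮J _ _ = ⊥-elim (n≮J n<J)
      ... | tri> n≮J _ _ = ⊥-elim (n≮J n<J)

      p-J : p J ≡ cJ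
      p-J with ℕP.<-cmp J J
      ... | tri< _ J≢J _ = ⊥-elim (J≢J refl)
      ... | tri≈ _ _ _ = refl
      ... | tri> _ J≢J _ = ⊥-elim (J≢J refl)

      p->J : ∀ n → J ℕ.< n → p n ≡ 0ℚ
      p->J n J<n with ℕP.<-cmp n J
      ... | tri< _ _ n≯J = ⊥-elim (n≯J J<n)
      ... | tri≈ _ _ n≯J = ⊥-elim (n≯J J<n)
      ... | tri> _ _ _ = refl

      cJ<sJ : cJ ℚ.< s J
      cJ<sJ = subst (cJ ℚ.<_) (sym (s-den J 1≤J (ℕP.n≤1+n J)))
        (cOver-anti-< J 1≤J (s≤s z≤n) (den-pos m₁∈S J 1≤J) ℕP.≤-refl)

      bumped-pos : ∀ n → 1 ℕ.≤ n → n ℕ.≤ J → 0 ℕ.< bumped n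
      bumped-pos n h n≤J with ℕP.m≤n⇒m<n∨m≡n n≤J
      ... | inj₁ n<J = subst (0 ℕ.<_) (sym (bumped-<J n n<J)) (den-pos m₁∈S n h)
      ... | inj₂ refl = subst (0 ℕ.<_) (sym bumped-J) (s≤s z≤n)

      p-cOver : ∀ n (h : 1 ℕ.≤ n) (n≤J : n ℕ.≤ J) → p n ≡ cOver C n (bumped n) (bumped-pos n h n≤J)
      p-cOver n h n≤J with ℕP.m≤n⇒m<n∨m≡n n≤J
      ... | inj₁ n<J = trans (p-<J n n<J) (trans (s-den n h (ℕP.≤-trans (ℕP.<⇒≤ n<J) (ℕP.n≤1+n J)))
                         (cOver-cong n (den-pos m₁∈S n h) (bumped-pos n h n≤J) (sym (bumped-<J n n<J))))
      ... | inj₂ refl = trans p-J (cOver-cong J (s≤s z≤n) (bumped-pos J h n≤J) (sym bumped-J))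

      bumped-grows : ∀ n (h : 1 ℕ.≤ n) → suc n ℕ.≤ J →
                     ratio C n h * (bumped n * (bumped n + 1)) ℕ.≤ bumped (suc n)
      bumped-grows n h n+1≤J rewrite bumped-<J n n+1≤J with ℕP.m≤n⇒m<n∨m≡n n+1≤J
      ... | inj₁ n+1<J rewrite bumped-<J (suc n) n+1<J = Witness.agrow (den-witness m₁∈S) n h
      ... | inj₂ refl rewrite bumped-J = ℕP.m≤n⇒m≤1+n (Witness.agrow (den-witness m₁∈S) n h)

      bumped-strict : ∀ n (h : 1 ℕ.≤ n) → suc n ≡ J →
                      ratio C n h * (bumped n * (bumped n + 1)) ℕ.< bumped (suc n)
      bumped-strict n h refl rewrite bumped-<J n ℕP.≤-refl | bumped-J = s≤s (Witness.agrow (den-witness m₁∈S) n h)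

      p-≤1 : ∀ n → 1 ℕ.≤ n → n ℕ.≤ J → p n ℚ.≤ 1ℚ
      p-≤1 n h n≤J with ℕP.m≤n⇒m<n∨m≡n n≤J
      ... | inj₁ n<J = subst (ℚ._≤ 1ℚ) (sym (p-<J n n<J)) (s-≤1 n h (ℕP.≤-trans (ℕP.<⇒≤ n<J) (ℕP.n≤1+n J)))
      ... | inj₂ refl = subst (ℚ._≤ 1ℚ) (sym p-J) (ℚP.≤-trans (ℚP.<⇒≤ cJ<sJ) (s-≤1 J h (ℕP.n≤1+n J)))

      p∈S : InS C p
      p∈S = FiniteSupport.InS-finite p bumped J bumped-pos p-cOver p->J bumped-grows bumped-strict
        (integer m₁∈S , trans (p-<J 0 (s≤s z≤n)) s-integer) p-≤1 (λ ())

      nothing-between : ∀ {v} → InS C v → LexAt J (v J) (p J) → ¬ LexAt J (v J) (s J) → v J ≡ s J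
      nothing-between {v} v∈S l v⊀s = trans (entry-den v∈S J 1≤J vJ≢0)
        (trans (cOver-cong J (den-pos v∈S J 1≤J) (den-pos m₁∈S J 1≤J) den-v≡a) (sym (s-den J 1≤J (ℕP.n≤1+n J))))
        where
        cJ<vJ : cJ ℚ.< v J
        cJ<vJ = subst (ℚ._< v J) p-J (descending-even i l)
        vJ≢0 : v J ≢ 0ℚ
        vJ≢0 vJ≡0 = ℚ<⇒≱ (ℚP.<-trans (cOver-pos J 1≤J (s≤s z≤n)) cJ<vJ) (ℚP.≤-reflexive vJ≡0)
        den-v<1+a : den v∈S J ℕ.< suc (a J)
        den-v<1+a = cOver-cancel-< J 1≤J (s≤s z≤n) (den-pos v∈S J 1≤J)
          (subst (cJ ℚ.<_) (entry-den v∈S J 1≤J vJ≢0) cJ<vJ)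
        a≤den-v : a J ℕ.≤ den v∈S J
        a≤den-v = cOver-cancel-≤ J 1≤J (den-pos v∈S J 1≤J) (den-pos m₁∈S J 1≤J)
          (subst₂ ℚ._≤_ (entry-den v∈S J 1≤J vJ≢0) (s-den J 1≤J (ℕP.n≤1+n J)) (ℚP.≮⇒≥ (v⊀s ∘ atEven {i})))
        den-v≡a : den v∈S J ≡ a J
        den-v≡a = ℕP.≤-antisym (ℕP.≤-pred den-v<1+a) a≤den-v

      -- a K already equals the least denominator that the growth condition allows after a J
      s-extreme-at-K : ∀ {v} → InS C v → Agree v s K → ¬ LexAt K (s K) (v K)
      s-extreme-at-K {v} v∈S v-agrees l = ℚ<⇒≱ sK<vK
        (subst₂ ℚ._≤_ (sym (entry-den v∈S K 1≤K vK≢0)) (sym (s-den K 1≤K ℕP.≤-refl))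
          (cOver-anti-≤ K (den-pos v∈S K 1≤K) (den-pos m₁∈S K 1≤K) (ℕP.≤-trans aK≤growth growth-v)))
        where
        sK<vK : s K ℚ.< v K
        sK<vK = ascending-odd (suc i) l
        vK≢0 : v K ≢ 0ℚ
        vK≢0 vK≡0 = ℚ<⇒≱ (subst (s K ℚ.<_) vK≡0 sK<vK)
          (subst (0ℚ ℚ.≤_) (m₁-agrees K ℕP.≤-refl) (entry-nonneg m₁∈S K 1≤K))
        growth-v : ratio C J 1≤J * (a J * (a J + 1)) ℕ.≤ den v∈S K
        growth-v = subst (λ x → ratio C J 1≤J * (x * (x + 1)) ℕ.≤ den v∈S K)
          (den-s v∈S J 1≤J (ℕP.n≤1+n J) (v-agrees J ℕP.≤-refl)) (Witness.agrow (den-witness v∈S) J 1≤J)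

      no-zero-completion : ∀ {v} → InS C v → Agree v s k → v k ≢ 0ℚ
      no-zero-completion v∈S v-agrees with Witness.strict (den-witness v∈S) J 1≤J
        (λ vK≡0 → s-nonzero K (s≤s z≤n) ℕP.≤-refl (trans (sym (v-agrees K ℕP.≤-refl)) vK≡0))
      ... | inj₁ vk≢0 = vk≢0
      ... | inj₂ strict = ⊥-elim (not-strict (subst₂ (λ x y → ratio C J 1≤J * (x * (x + 1)) ℕ.< y)
          (den-s v∈S J 1≤J (ℕP.n≤1+n J) (v-agrees J (ℕP.n≤1+n K)))
          (den-s v∈S K (s≤s z≤n) ℕP.≤-refl (v-agrees K ℕP.≤-refl)) strict))

      open Jump p p∈S p-<J (atEven {i} (subst (ℚ._< s J) (sym p-J) cJ<sJ)) p->J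
        nothing-between s-extreme-at-K no-zero-completion public

  stuck-sup : ∀ k → IndexView k → Reached k → ¬ Reached (suc k) → ∃[ w ] IsSup C M w
  stuck-sup _ origin _ ¬r = ⊥-elim (¬r (proj₂ (optimal⇒maximal 0 optimal-origin)))
  stuck-sup _ (odd j) r ¬r =
    ⊥-elim (¬r (proj₂ (optimal⇒maximal _ (optimal-ascending _ (s≤s z≤n) (ascending-odd j) r))))
  stuck-sup _ (even zero) r ¬r with s 1 ℚP.≟ 1ℚ
  ... | yes s1≡1 = IntegerJump.p-sup r ¬r s1≡1
  ... | no s1≢1 = Stuck.Truncation.t-sup 0 r ¬r (λ _ → s1≢1) (λ ())
  stuck-sup _ (even (suc i)) r ¬r with em {ratio C J (s≤s z≤n) * (a J * (a J + 1)) ℕ.< a K}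
    where
    open Stuck (suc i) r ¬r
  ... | yes strict = Stuck.Truncation.t-sup (suc i) r ¬r (λ ()) (λ _ → strict)
  ... | no not-strict = DenominatorJump.p-sup i r ¬r not-strict

  supremum : ∃[ w ] IsSup C M w
  supremum with em {∀ k → Reached k}
  ... | yes reached = AllReached.s-sup reached
  ... | no ¬reached with first-failure Reached reached-0 ¬reached
  ...   | k , r , ¬r = stuck-sup k (indexView k) r ¬r

theorem3p7 : ExcludedMiddle 0ℓ → (C : Cseq) → (M : Seq → Set) →
    (∀ q → M q → InS C q) → (∃[ q ] M q) →
    (BoundedAbove C M → ∃[ s ] IsSup C M s) × (BoundedBelow C M → ∃[ s ] IsInf C M s)
theorem3p7 em C M M⊆S (m₀ , m₀∈M) = sup , inf
  where
  sup : BoundedAbove C M → ∃[ s ] IsSup C M s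
  sup (u , u∈S , u-ub) = Supremum.supremum em C M M⊆S m₀ m₀∈M u u∈S u-ub
  -- the infimum of M is the supremum of its lower bounds, which m₀ bounds from above
  inf : BoundedBelow C M → ∃[ s ] IsInf C M s
  inf (l , l-lb) with Supremum.supremum em C (IsLowerBound C M) (λ _ → proj₁) l l-lb
                        m₀ (M⊆S m₀ m₀∈M) (λ _ lb → proj₂ lb m₀ m₀∈M)
  ... | w , (w∈S , lbs≼w) , w-least =
    w , (w∈S , λ q q∈M → w-least q (M⊆S q q∈M , λ _ lb → proj₂ lb q q∈M)) , lbs≼w
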